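{- Let $j$ be a positive integer. Then there exists a nontrivial Zeckendorf collection $\mathcal{E}$ for positive integers such that $j+\mathbb{N}=\{j+n:n\in\mathbb{N}\}$ is an $\mathcal{E}$-subset of $\mathbb{N}$.
   Context: $\mathbb{N}=\{1,2,\dots\}$. A coefficient function is a map $\epsilon:\mathbb{N}\to\{0,1,2,\dots\}$; $\sum\epsilon Q=\sum_k\epsilon_kQ_k$; $\beta^i$ has $\beta^i_i=1$ and $0$ elsewhere. For finite-support functions, $\mu<_a\mu'$ means at the largest index where they differ $\mu$ has the smaller value. A Zeckendorf collection for positive integers is a set $\mathcal{E}$ of finite-support coefficient functions containing $0$ and all $\beta^i$, ordered by $<_a$, with $\hat\beta^n$ the largest element below $\beta^n$, such that (1) each $\mu\in\mathcal{E}$ has finitely many elements below it, and (2) for $\mu\in\mathcal{E}$, if its immediate successor (smallest greater element) $\tilde\mu$ is not $\beta^1+\mu$, then there is $n\ge2$ with $\mu_k=\hat\beta^n_k$ for $k<n$ and $\tilde\mu=\beta^n+\sum_{k\ge n}\mu_k\beta^k$. It is nontrivial if $\mathcal{E}\ne\{0\}\cup\{\beta^n:n\ge1\}$. A subset $Y\subseteq\mathbb{N}$ is an $\mathcal{E}$-subset if there is a sequence $Q$ of positive integers such that the values $\sum\delta Q$, $\delta\in\mathcal{E}$, are pairwise distinct and $\{\sum\delta Q:\delta\in\mathcal{E},\delta\ne0\}=Y$. -}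

module Defs where

open import Data.Nat using (ℕ; zero; suc; _+_; _*_; _≤_; _<_)
open import Data.Nat.Properties using (_≟_; _≤?_)
open import Data.Product using (Σ; ∃; _×_; _,_)
open import Data.Sum using (_⊎_)
open import Data.List using (List)
open import Data.List.Relation.Unary.Any using (Any)
open import Relation.Nullary using (¬_; yes; no)
open import Relation.Binary.PropositionalEquality using (_≡_)

-- A coefficient function N = {1,2,...} → {0,1,2,...}, represented as a
-- function ℕ → ℕ whose value at the unused index 0 is required to be 0.
Coeff : Set
Coeff = ℕ → ℕ

IsCoeffFn : Coeff → Set
IsCoeffFn ε = ε 0 ≡ 0

FiniteSupport : Coeff → Set
FiniteSupport ε = ∃ λ N → ∀ k → N < k → ε k ≡ 0

_≐_ : Coeff → Coeff → Set
μ ≐ ν = ∀ k → μ k ≡ ν k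

zeroC : Coeff
zeroC _ = 0

β : ℕ → Coeff
β i k with k ≟ i
... | yes _ = 1
... | no _ = 0

_⊕_ : Coeff → Coeff → Coeff
(μ ⊕ ν) k = μ k + ν k

-- μ restricted to indices ≥ n, i.e.  Σ_{k ≥ n} μ_k β^k
restrictFrom : ℕ → Coeff → Coeff
restrictFrom n μ k with n ≤? k
... | yes _ = μ k
... | no _ = 0

_<ₐ_ : Coeff → Coeff → Set
μ <ₐ μ' = ∃ λ m → μ m < μ' m × (∀ k → m < k → μ k ≡ μ' k)

_≤ₐ_ : Coeff → Coeff → Set
μ ≤ₐ μ' = μ <ₐ μ' ⊎ μ ≐ μ'

Collection : Set₁
Collection = Coeff → Set

IsHatBeta : Collection → ℕ → Coeff → Set
IsHatBeta 𝓔 n ν = 𝓔 ν × ν <ₐ β n × (∀ ν' → 𝓔 ν' → ν' <ₐ β n → ν' ≤ₐ ν)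

IsSucc : Collection → Coeff → Coeff → Set
IsSucc 𝓔 μ μ̃ = 𝓔 μ̃ × μ <ₐ μ̃ × (∀ ν → 𝓔 ν → μ <ₐ ν → μ̃ ≤ₐ ν)

record ZeckendorfCollection (𝓔 : Collection) : Set where
  field
    coeffFn     : ∀ μ → 𝓔 μ → IsCoeffFn μ
    finSupp     : ∀ μ → 𝓔 μ → FiniteSupport μ
    hasZero     : 𝓔 zeroC
    hasBeta     : ∀ i → 1 ≤ i → 𝓔 (β i)
    finiteBelow : ∀ μ → 𝓔 μ →
                  ∃ λ (L : List Coeff) → ∀ ν → 𝓔 ν → ν <ₐ μ → Any (ν ≐_) L
    succCond    : ∀ μ μ̃ → 𝓔 μ → IsSucc 𝓔 μ μ̃ → ¬ (μ̃ ≐ (β 1 ⊕ μ)) →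
                  ∃ λ n → 2 ≤ n × ∃ λ β̂ → IsHatBeta 𝓔 n β̂ ×
                    (∀ k → k < n → μ k ≡ β̂ k) ×
                    (μ̃ ≐ (β n ⊕ restrictFrom n μ))

-- 𝓔 ≠ {0} ∪ {β^n : n ≥ 1}  (given that 𝓔 contains all of these)
Nontrivial : Collection → Set
Nontrivial 𝓔 = ∃ λ μ → 𝓔 μ × ¬ (μ ≐ zeroC) × (∀ n → 1 ≤ n → ¬ (μ ≐ β n))

partialSum : ℕ → Coeff → (ℕ → ℕ) → ℕ
partialSum zero δ Q = 0
partialSum (suc N) δ Q = partialSum N δ Q + δ (suc N) * Q (suc N)

SumIs : Coeff → (ℕ → ℕ) → ℕ → Set
SumIs δ Q s = ∃ λ N → (∀ k → N < k → δ k ≡ 0) × s ≡ partialSum N δ Q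

IsESubset : Collection → (ℕ → Set) → Set
IsESubset 𝓔 Y = ∃ λ (Q : ℕ → ℕ) →
    (∀ k → 1 ≤ k → 1 ≤ Q k) ×
    (∀ δ δ' s s' → 𝓔 δ → 𝓔 δ' → SumIs δ Q s → SumIs δ' Q s' → s ≡ s' → δ ≐ δ') ×
    (∀ y → (1 ≤ y × Y y) → ∃ λ δ → 𝓔 δ × ¬ (δ ≐ zeroC) × SumIs δ Q y) ×
    (∀ y δ → 𝓔 δ → ¬ (δ ≐ zeroC) → SumIs δ Q y → 1 ≤ y × Y y)

-- j + ℕ = {j + n : n ∈ ℕ, n ≥ 1}
shiftN : ℕ → ℕ → Set
shiftN j y = ∃ λ n → 1 ≤ n × y ≡ j + n

{-# OPTIONS --safe #-}
module Submission where

open import Defs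
open import Data.Nat using (ℕ; zero; suc; _+_; _*_; _≤_; _<_; z≤n; s≤s)
open import Data.Nat.Properties
open import Data.Nat.Tactic.RingSolver using (solve-∀)
open import Function using (_∘_)
open import Data.Product using (∃; _×_; _,_)
open import Data.Sum using (_⊎_; inj₁; inj₂)
open import Data.List using (List; []; _∷_)
open import Data.List.Relation.Unary.Any using (Any; here; there)
open import Relation.Nullary using (¬_; yes; no; contradiction)
open import Relation.Binary.PropositionalEquality
open import Relation.Binary.Definitions using (tri<; tri≈; tri>)

-- Take 𝓔 = {0, β¹, 2β¹, β², β³, …}. Listed in <ₐ-order, each element arises from
-- its predecessor μ either as β¹ + μ or as a fresh β^n with μ supported below n; in
-- the latter case β̂^n = μ, so condition (2) holds.
-- With Q_k = j + q_k, where q enumerates ℕ skipping the value j + 2, the sums of the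
-- elements of 𝓔 are j + o_c for the offsets o = 0, 1, j + 2, q_2, q_3, … (apart from
-- the sum 0 of the zero element): 2β¹ contributes exactly the value q misses, so o is
-- a permutation of ℕ and every j + n is attained exactly once.

β-self : ∀ i → β i i ≡ 1
β-self i with i ≟ i
... | yes _ = refl
... | no i≢i = contradiction refl i≢i

β-other : ∀ {i k} → k ≢ i → β i k ≡ 0
β-other {i} {k} k≢i with k ≟ i
... | yes k≡i = contradiction k≡i k≢i
... | no _ = refl

β≤1 : ∀ i k → β i k ≤ 1
β≤1 i k with k ≟ i
... | yes _ = s≤s z≤n
... | no _ = z≤n

≐-sym : ∀ {μ ν} → μ ≐ ν → ν ≐ μ
≐-sym eq k = sym (eq k)

≐-trans : ∀ {μ ν ρ} → μ ≐ ν → ν ≐ ρ → μ ≐ ρ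
≐-trans eq eq′ k = trans (eq k) (eq′ k)

<ₐ-resp-≐ : ∀ {μ μ′ ν ν′} → μ ≐ μ′ → ν ≐ ν′ → μ <ₐ ν → μ′ <ₐ ν′
<ₐ-resp-≐ μ≐μ′ ν≐ν′ (m , lt , above) =
  m , subst₂ _<_ (μ≐μ′ m) (ν≐ν′ m) lt ,
  λ k m<k → trans (sym (μ≐μ′ k)) (trans (above k m<k) (ν≐ν′ k))

≤ₐ-resp-≐ : ∀ {μ μ′ ν ν′} → μ ≐ μ′ → ν ≐ ν′ → μ ≤ₐ ν → μ′ ≤ₐ ν′
≤ₐ-resp-≐ μ≐μ′ ν≐ν′ (inj₁ μ<ν) = inj₁ (<ₐ-resp-≐ μ≐μ′ ν≐ν′ μ<ν)
≤ₐ-resp-≐ μ≐μ′ ν≐ν′ (inj₂ μ≐ν) = inj₂ (≐-trans (≐-sym μ≐μ′) (≐-trans μ≐ν ν≐ν′))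

<ₐ-irrefl : ∀ {μ ν} → μ ≐ ν → ¬ (μ <ₐ ν)
<ₐ-irrefl μ≐ν (m , lt , _) = <-irrefl (μ≐ν m) lt

<ₐ-trans : ∀ {μ ν ρ} → μ <ₐ ν → ν <ₐ ρ → μ <ₐ ρ
<ₐ-trans {μ} {ν} {ρ} (m , lt , above) (m′ , lt′ , above′) with <-cmp m m′
... | tri< m<m′ _ _ =
  m′ , subst (_< ρ m′) (sym (above m′ m<m′)) lt′ ,
  λ k m′<k → trans (above k (<-trans m<m′ m′<k)) (above′ k m′<k)
... | tri≈ _ refl _ = m , <-trans lt lt′ , λ k m<k → trans (above k m<k) (above′ k m<k)
... | tri> _ _ m′<m =
  m , subst (μ m <_) (above′ m m′<m) lt ,
  λ k m<k → trans (above k m<k) (above′ k (<-trans m′<m m<k))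

<ₐ-asym : ∀ {μ ν} → μ <ₐ ν → ¬ (ν <ₐ μ)
<ₐ-asym μ<ν ν<μ = <ₐ-irrefl (λ _ → refl) (<ₐ-trans μ<ν ν<μ)

data Step (μ μ̃ : Coeff) : Set where
  increment : μ̃ ≐ (β 1 ⊕ μ) → Step μ μ̃
  carry     : ∀ n → 2 ≤ n → μ̃ ≐ β n → (∀ k → n ≤ k → μ k ≡ 0) → Step μ μ̃

step⇒<ₐ : ∀ {μ μ̃} → Step μ μ̃ → μ <ₐ μ̃
step⇒<ₐ {μ} (increment eq) =
  1 , subst (μ 1 <_) (sym (eq 1)) ≤-refl ,
  λ k 1<k → sym (trans (eq k) (cong (_+ μ k) (β-other (<⇒≢ 1<k ∘ sym))))
step⇒<ₐ {μ} (carry n _ eq vanish) =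
  n , subst₂ _<_ (sym (vanish n ≤-refl)) (sym (trans (eq n) (β-self n))) ≤-refl ,
  λ k n<k → trans (vanish k (<⇒≤ n<k)) (sym (trans (eq k) (β-other (<⇒≢ n<k ∘ sym))))

restrictFrom-vanishing : ∀ {n μ} → (∀ k → n ≤ k → μ k ≡ 0) → restrictFrom n μ ≐ zeroC
restrictFrom-vanishing {n} vanish k with n ≤? k
... | yes n≤k = vanish k n≤k
... | no _ = refl

partialSum-cong : ∀ N {δ δ′} Q → δ ≐ δ′ → partialSum N δ Q ≡ partialSum N δ′ Q
partialSum-cong zero Q _ = refl
partialSum-cong (suc N) Q δ≐δ′ =
  cong₂ _+_ (partialSum-cong N Q δ≐δ′) (cong (_* Q (suc N)) (δ≐δ′ (suc N)))

partialSum-stable : ∀ {N δ Q} M → (∀ k → N < k → δ k ≡ 0) → N ≤ M →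
                    partialSum M δ Q ≡ partialSum N δ Q
partialSum-stable M vanish N≤M with m≤n⇒m<n∨m≡n N≤M
... | inj₂ refl = refl
partialSum-stable {N} {δ} {Q} (suc M) vanish _ | inj₁ (s≤s N≤M) = begin
  partialSum M δ Q + δ (suc M) * Q (suc M)  ≡⟨ cong (λ x → partialSum M δ Q + x * Q (suc M))
                                                     (vanish (suc M) (s≤s N≤M)) ⟩
  partialSum M δ Q + 0                      ≡⟨ +-identityʳ _ ⟩
  partialSum M δ Q                          ≡⟨ partialSum-stable M vanish N≤M ⟩
  partialSum N δ Q                          ∎
  where open ≡-Reasoning

partialSum-β-below : ∀ {N i} Q → N < i → partialSum N (β i) Q ≡ 0
partialSum-β-below {zero} Q _ = refl
partialSum-β-below {suc N} {i} Q N+1<i =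
  cong₂ _+_ (partialSum-β-below Q (<-trans ≤-refl N+1<i))
            (cong (_* Q (suc N)) (β-other (<⇒≢ N+1<i)))

sumIs-functional : ∀ {δ Q s t} → SumIs δ Q s → SumIs δ Q t → s ≡ t
sumIs-functional (N , vanishN , refl) (M , vanishM , refl) with ≤-total N M
... | inj₁ N≤M = sym (partialSum-stable M vanishN N≤M)
... | inj₂ M≤N = partialSum-stable N vanishM M≤N

sumIs-resp-≐ : ∀ {δ δ′ Q s} → δ ≐ δ′ → SumIs δ Q s → SumIs δ′ Q s
sumIs-resp-≐ {Q = Q} δ≐δ′ (N , vanish , s≡) =
  N , (λ k N<k → trans (sym (δ≐δ′ k)) (vanish k N<k)) , trans s≡ (partialSum-cong N Q δ≐δ′)

sumIs-β : ∀ Q {i} → 1 ≤ i → SumIs (β i) Q (Q i)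
sumIs-β Q {suc i} _ = suc i , (λ k i<k → β-other (<⇒≢ i<k ∘ sym)) , sym (begin
  partialSum i (β (suc i)) Q + β (suc i) (suc i) * Q (suc i)
    ≡⟨ cong₂ _+_ (partialSum-β-below {i} Q ≤-refl) (cong (_* Q (suc i)) (β-self (suc i))) ⟩
  1 * Q (suc i)
    ≡⟨ *-identityˡ (Q (suc i)) ⟩
  Q (suc i)  ∎)
  where open ≡-Reasoning

module Enumeration (e : ℕ → Coeff) (e-zero : e 0 ≐ zeroC)
                   (e-step : ∀ c → Step (e c) (e (suc c))) where

  Range : Collection
  Range μ = ∃ λ c → μ ≐ e c

  e-strictMono : ∀ {a b} → a < b → e a <ₐ e b
  e-strictMono {a} {suc b} (s≤s a≤b) with m≤n⇒m<n∨m≡n a≤b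
  ... | inj₁ a<b = <ₐ-trans (e-strictMono a<b) (step⇒<ₐ (e-step b))
  ... | inj₂ refl = step⇒<ₐ (e-step a)

  e-<ₐ⇒< : ∀ {a b} → e a <ₐ e b → a < b
  e-<ₐ⇒< {a} {b} ea<eb with <-cmp a b
  ... | tri< a<b _ _ = a<b
  ... | tri≈ _ refl _ = contradiction ea<eb (<ₐ-irrefl (λ _ → refl))
  ... | tri> _ _ b<a = contradiction (e-strictMono b<a) (<ₐ-asym ea<eb)

  e-injective : ∀ {a b} → e a ≐ e b → a ≡ b
  e-injective {a} {b} ea≐eb with <-cmp a b
  ... | tri< a<b _ _ = contradiction (e-strictMono a<b) (<ₐ-irrefl ea≐eb)
  ... | tri≈ _ a≡b _ = a≡b
  ... | tri> _ _ b<a = contradiction (e-strictMono b<a) (<ₐ-irrefl (≐-sym ea≐eb))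

  e-≤⇒≤ₐ : ∀ {a b} → a ≤ b → e a ≤ₐ e b
  e-≤⇒≤ₐ a≤b with m≤n⇒m<n∨m≡n a≤b
  ... | inj₁ a<b = inj₁ (e-strictMono a<b)
  ... | inj₂ refl = inj₂ (λ _ → refl)

  e-≤ₐ⇒≤ : ∀ {a b} → e a ≤ₐ e b → a ≤ b
  e-≤ₐ⇒≤ (inj₁ ea<eb) = <⇒≤ (e-<ₐ⇒< ea<eb)
  e-≤ₐ⇒≤ (inj₂ ea≐eb) = ≤-reflexive (e-injective ea≐eb)

  e-coeffFn : ∀ c → IsCoeffFn (e c)
  e-coeffFn zero = e-zero 0
  e-coeffFn (suc c) with e-step c
  ... | increment eq = trans (eq 0) (e-coeffFn c)
  ... | carry n 2≤n eq _ = trans (eq 0) (β-other (<⇒≢ (<-trans (s≤s z≤n) 2≤n)))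

  e-finiteSupport : ∀ c → FiniteSupport (e c)
  e-finiteSupport zero = 0 , λ k _ → e-zero k
  e-finiteSupport (suc c) with e-step c | e-finiteSupport c
  ... | increment eq | N , vanish =
    suc N , λ k N+1<k → trans (eq k)
      (cong₂ _+_ (β-other (<⇒≢ (≤-<-trans (s≤s z≤n) N+1<k) ∘ sym))
                 (vanish k (<-trans ≤-refl N+1<k)))
  ... | carry n _ eq _ | _ = n , λ k n<k → trans (eq k) (β-other (<⇒≢ n<k ∘ sym))

  below : ℕ → List Coeff
  below zero = []
  below (suc c) = e c ∷ below c

  below-complete : ∀ {ν c d} → d < c → ν ≐ e d → Any (ν ≐_) (below c)
  below-complete {c = suc c} (s≤s d≤c) ν≐ed with m≤n⇒m<n∨m≡n d≤c
  ... | inj₁ d<c = there (below-complete d<c ν≐ed)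
  ... | inj₂ refl = here ν≐ed

  isSucc⇒≐suc : ∀ {μ μ̃ c} → μ ≐ e c → IsSucc Range μ μ̃ → μ̃ ≐ e (suc c)
  isSucc⇒≐suc {c = c} μ≐ec ((d , μ̃≐ed) , μ<μ̃ , least) =
    subst (λ x → _ ≐ e x) d≡c+1 μ̃≐ed
    where
    c<d : c < d
    c<d = e-<ₐ⇒< (<ₐ-resp-≐ μ≐ec μ̃≐ed μ<μ̃)
    d≤c+1 : d ≤ suc c
    d≤c+1 = e-≤ₐ⇒≤ (≤ₐ-resp-≐ μ̃≐ed (λ _ → refl)
      (least (e (suc c)) (suc c , λ _ → refl)
             (<ₐ-resp-≐ (≐-sym μ≐ec) (λ _ → refl) (step⇒<ₐ (e-step c)))))
    d≡c+1 : d ≡ suc c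
    d≡c+1 = ≤-antisym d≤c+1 c<d

  isHatBeta : ∀ {c n} → e (suc c) ≐ β n → IsHatBeta Range n (e c)
  isHatBeta {c} ec+1≐βn =
    (c , λ _ → refl) ,
    <ₐ-resp-≐ (λ _ → refl) ec+1≐βn (step⇒<ₐ (e-step c)) ,
    λ ν (d , ν≐ed) ν<βn → ≤ₐ-resp-≐ (≐-sym ν≐ed) (λ _ → refl)
      (e-≤⇒≤ₐ (≤-pred (e-<ₐ⇒< (<ₐ-resp-≐ ν≐ed (≐-sym ec+1≐βn) ν<βn))))

  range-succCond : ∀ μ μ̃ → Range μ → IsSucc Range μ μ̃ → ¬ (μ̃ ≐ (β 1 ⊕ μ)) →
                   ∃ λ n → 2 ≤ n × ∃ λ β̂ → IsHatBeta Range n β̂ ×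
                     (∀ k → k < n → μ k ≡ β̂ k) ×
                     (μ̃ ≐ (β n ⊕ restrictFrom n μ))
  range-succCond μ μ̃ (c , μ≐ec) succ not-increment with e-step c
  ... | increment eq =
    contradiction (≐-trans (isSucc⇒≐suc μ≐ec succ)
                           (≐-trans eq λ k → cong (β 1 k +_) (sym (μ≐ec k))))
                  not-increment
  ... | carry n 2≤n eq vanish =
    n , 2≤n , e c , isHatBeta eq , (λ k _ → μ≐ec k) ,
    λ k → begin
      μ̃ k                          ≡⟨ isSucc⇒≐suc μ≐ec succ k ⟩
      e (suc c) k                  ≡⟨ eq k ⟩
      β n k                        ≡⟨ +-identityʳ (β n k) ⟨
      β n k + 0                    ≡⟨ cong (β n k +_) (restrictFrom-vanishing vanishμ k) ⟨
      β n k + restrictFrom n μ k   ∎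
    where
    open ≡-Reasoning
    vanishμ : ∀ k → n ≤ k → μ k ≡ 0
    vanishμ k n≤k = trans (μ≐ec k) (vanish k n≤k)

  range-zeckendorf : (∀ i → 1 ≤ i → Range (β i)) → ZeckendorfCollection Range
  range-zeckendorf hasBeta = record
    { coeffFn     = λ μ (c , μ≐ec) → trans (μ≐ec 0) (e-coeffFn c)
    ; finSupp     = λ μ (c , μ≐ec) → finSupp μ≐ec (e-finiteSupport c)
    ; hasZero     = 0 , ≐-sym e-zero
    ; hasBeta     = hasBeta
    ; finiteBelow = λ μ (c , μ≐ec) →
        below c , λ ν (d , ν≐ed) ν<μ →
          below-complete (e-<ₐ⇒< (<ₐ-resp-≐ ν≐ed μ≐ec ν<μ)) ν≐ed
    ; succCond    = range-succCond
    }
    where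
    finSupp : ∀ {μ ν} → μ ≐ ν → FiniteSupport ν → FiniteSupport μ
    finSupp μ≐ν (N , vanish) = N , λ k N<k → trans (μ≐ν k) (vanish k N<k)

  range-isESubset : ∀ {Y} (Q value : ℕ → ℕ) →
                    (∀ k → 1 ≤ k → 1 ≤ Q k) →
                    (∀ c → SumIs (e c) Q (value c)) →
                    (∀ {a b} → value a ≡ value b → a ≡ b) →
                    (∀ y → 1 ≤ y → Y y → ∃ λ c → value (suc c) ≡ y) →
                    (∀ c → 1 ≤ value (suc c) × Y (value (suc c))) →
                    IsESubset Range Y
  range-isESubset {Y} Q value Q-pos sumIs-value value-injective value-onto value-into =
    Q , Q-pos , distinct , onto , into
    where
    sum≡value : ∀ {δ c s} → δ ≐ e c → SumIs δ Q s → s ≡ value c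
    sum≡value δ≐ec sum = sumIs-functional (sumIs-resp-≐ δ≐ec sum) (sumIs-value _)

    distinct : ∀ δ δ′ s s′ → Range δ → Range δ′ → SumIs δ Q s → SumIs δ′ Q s′ →
               s ≡ s′ → δ ≐ δ′
    distinct _ _ _ _ (c , δ≐ec) (c′ , δ′≐ec′) sum sum′ s≡s′
      with refl ← value-injective (trans (sym (sum≡value δ≐ec sum))
                                          (trans s≡s′ (sum≡value δ′≐ec′ sum′)))
      = ≐-trans δ≐ec (≐-sym δ′≐ec′)

    nonzero : ∀ c → ¬ (e (suc c) ≐ zeroC)
    nonzero c ec+1≐0 =
      <ₐ-irrefl (≐-trans e-zero (≐-sym ec+1≐0)) (e-strictMono (s≤s z≤n))

    onto : ∀ y → 1 ≤ y × Y y → ∃ λ δ → Range δ × ¬ (δ ≐ zeroC) × SumIs δ Q y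
    onto y (1≤y , Yy) with value-onto y 1≤y Yy
    ... | c , refl = e (suc c) , (suc c , λ _ → refl) , nonzero c , sumIs-value (suc c)

    into : ∀ y δ → Range δ → ¬ (δ ≐ zeroC) → SumIs δ Q y → 1 ≤ y × Y y
    into y δ (zero , δ≐e0) δ≢0 _ = contradiction (≐-trans δ≐e0 e-zero) δ≢0
    into y δ (suc c , δ≐ec) _ sum rewrite sum≡value δ≐ec sum = value-into c

skip : ℕ → ℕ → ℕ
skip s k with k <? s
... | yes _ = k
... | no _ = suc k

skip-view : ∀ s k → (k < s × skip s k ≡ k) ⊎ (s ≤ k × skip s k ≡ suc k)
skip-view s k with k <? s
... | yes k<s = inj₁ (k<s , refl)
... | no k≮s = inj₂ (≮⇒≥ k≮s , refl)

n≤skip : ∀ s k → k ≤ skip s k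
n≤skip s k with skip-view s k
... | inj₁ (_ , eq) = ≤-reflexive (sym eq)
... | inj₂ (_ , eq) = subst (k ≤_) (sym eq) (n≤1+n k)

skip-≢ : ∀ s k → skip s k ≢ s
skip-≢ s k skip≡s with skip-view s k
... | inj₁ (k<s , eq) = <⇒≢ k<s (trans (sym eq) skip≡s)
... | inj₂ (s≤k , eq) = <⇒≢ (s≤s s≤k) (sym (trans (sym eq) skip≡s))

skip-injective : ∀ s {a b} → skip s a ≡ skip s b → a ≡ b
skip-injective s {a} {b} eq with skip-view s a | skip-view s b
... | inj₁ (_ , ea) | inj₁ (_ , eb) = trans (sym ea) (trans eq eb)
... | inj₁ (a<s , ea) | inj₂ (s≤b , eb) =
  contradiction (trans (sym ea) (trans eq eb)) (<⇒≢ (<-≤-trans a<s (m≤n⇒m≤1+n s≤b)))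
... | inj₂ (s≤a , ea) | inj₁ (b<s , eb) =
  contradiction (trans (sym eb) (trans (sym eq) ea)) (<⇒≢ (<-≤-trans b<s (m≤n⇒m≤1+n s≤a)))
... | inj₂ (_ , ea) | inj₂ (_ , eb) = suc-injective (trans (sym ea) (trans eq eb))

skip-cover : ∀ s n → n ≡ s ⊎ ∃ λ k → skip s k ≡ n
skip-cover s n with <-cmp n s
... | tri≈ _ n≡s _ = inj₁ n≡s
... | tri< n<s _ _ with skip-view s n
...   | inj₁ (_ , eq) = inj₂ (n , eq)
...   | inj₂ (s≤n , _) = contradiction s≤n (<⇒≱ n<s)
skip-cover s (suc k) | tri> _ _ (s≤s s≤k) with skip-view s k
...   | inj₁ (k<s , _) = contradiction s≤k (<⇒≱ k<s)
...   | inj₂ (_ , eq) = inj₂ (k , eq)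

enum : ℕ → Coeff
enum 0 = zeroC
enum 1 = β 1
enum 2 = β 1 ⊕ β 1
enum (suc (suc (suc m))) = β (suc (suc m))

enum-vanishing : ∀ m k → suc (suc m) ≤ k → enum (suc (suc m)) k ≡ 0
enum-vanishing zero k 2≤k = cong₂ _+_ (β-other k≢1) (β-other k≢1)
  where
  k≢1 : k ≢ 1
  k≢1 = <⇒≢ 2≤k ∘ sym
enum-vanishing (suc m) k m+3≤k = β-other (<⇒≢ m+3≤k ∘ sym)

enum-step : ∀ c → Step (enum c) (enum (suc c))
enum-step 0 = increment (λ k → sym (+-identityʳ (β 1 k)))
enum-step 1 = increment (λ _ → refl)
enum-step (suc (suc m)) = carry (suc (suc m)) (s≤s (s≤s z≤n)) (λ _ → refl) (enum-vanishing m)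

open Enumeration enum (λ _ → refl) enum-step

enum-hasBeta : ∀ i → 1 ≤ i → Range (β i)
enum-hasBeta (suc zero) _ = 1 , λ _ → refl
enum-hasBeta (suc (suc m)) _ = suc (suc (suc m)) , λ _ → refl

enum-nontrivial : Nontrivial Range
enum-nontrivial =
  β 1 ⊕ β 1 , (2 , λ _ → refl) , (λ eq → 1+n≢0 (eq 1)) ,
  λ n _ eq → <-irrefl refl (≤-trans (≤-reflexive (eq 1)) (β≤1 n 1))

module Shifted (j : ℕ) where

  weight : ℕ → ℕ
  weight k = j + skip (suc (suc j)) k

  offset : ℕ → ℕ
  offset 0 = 0
  offset 1 = 1
  offset 2 = suc (suc j)
  offset (suc (suc (suc m))) = skip (suc (suc j)) (suc (suc m))

  offset-skip : ∀ k → offset (skip 2 k) ≡ skip (suc (suc j)) k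
  offset-skip 0 = refl
  offset-skip 1 = refl
  offset-skip (suc (suc m)) = refl

  offset-injective : ∀ {a b} → offset a ≡ offset b → a ≡ b
  offset-injective {a} {b} eq with skip-cover 2 a | skip-cover 2 b
  ... | inj₁ refl | inj₁ refl = refl
  ... | inj₁ refl | inj₂ (k , refl) =
    contradiction (sym (trans eq (offset-skip k))) (skip-≢ (suc (suc j)) k)
  ... | inj₂ (k , refl) | inj₁ refl =
    contradiction (trans (sym (offset-skip k)) eq) (skip-≢ (suc (suc j)) k)
  ... | inj₂ (k , refl) | inj₂ (k′ , refl) =
    cong (skip 2) (skip-injective (suc (suc j)) {k} {k′}
      (trans (sym (offset-skip k)) (trans eq (offset-skip k′))))

  offset-surjective : ∀ n → ∃ λ c → offset c ≡ n
  offset-surjective n with skip-cover (suc (suc j)) n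
  ... | inj₁ refl = 2 , refl
  ... | inj₂ (k , refl) = skip 2 k , offset-skip k

  offset-pos : ∀ c → 1 ≤ offset (suc c)
  offset-pos c = n≢0⇒n>0 (λ eq → 1+n≢0 (offset-injective {suc c} {0} eq))

  total : ℕ → ℕ
  total zero = 0
  total (suc c) = j + offset (suc c)

  sumIs-total : ∀ c → SumIs (enum c) weight (total c)
  sumIs-total 0 = 0 , (λ _ _ → refl) , refl
  sumIs-total 1 = sumIs-β weight ≤-refl
  sumIs-total 2 = 1 , enum-vanishing 0 , doubled j
    where
    doubled : ∀ n → n + suc (suc n) ≡ (n + 1) + ((n + 1) + 0)
    doubled = solve-∀
  sumIs-total (suc (suc (suc m))) = sumIs-β weight (s≤s z≤n)

  total-injective : ∀ {a b} → total a ≡ total b → a ≡ b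
  total-injective {zero} {zero} _ = refl
  total-injective {zero} {suc b} eq =
    contradiction (offset-injective {suc b} {0} (m+n≡0⇒n≡0 j (sym eq))) 1+n≢0
  total-injective {suc a} {zero} eq =
    contradiction (offset-injective {suc a} {0} (m+n≡0⇒n≡0 j eq)) 1+n≢0
  total-injective {suc a} {suc b} eq = offset-injective (+-cancelˡ-≡ j _ _ eq)

  total-onto : ∀ y → 1 ≤ y → shiftN j y → ∃ λ c → total (suc c) ≡ y
  total-onto y _ (n , 1≤n , refl) with offset-surjective n
  ... | zero , refl = contradiction 1≤n λ ()
  ... | suc c , eq = c , cong (j +_) eq

  total-into : ∀ c → 1 ≤ total (suc c) × shiftN j (total (suc c))
  total-into c =
    ≤-trans (offset-pos c) (m≤n+m _ j) , offset (suc c) , offset-pos c , refl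

  weight-pos : ∀ k → 1 ≤ k → 1 ≤ weight k
  weight-pos k 1≤k = ≤-trans 1≤k (≤-trans (n≤skip _ k) (m≤n+m _ j))

-- The construction works for j = 0 as well.
proposition4p2 : ∀ (j : ℕ) → 1 ≤ j →
    ∃ λ (𝓔 : Collection) → ZeckendorfCollection 𝓔 × Nontrivial 𝓔 × IsESubset 𝓔 (shiftN j)
proposition4p2 j _ =
  Range , range-zeckendorf enum-hasBeta , enum-nontrivial ,
  range-isESubset weight total weight-pos sumIs-total total-injective total-onto total-into
  where open Shifted j
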